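{- Let $n,d,p$ be integers with $p\ge d+1\ge 2$, and let $\mathsf{A}$ be a $\mathsf{DHHF}(n;k,(w_1,\dots,w_n),n+d,p)$ with singleton array $\mathsf{B}$. Then for every set $\{c_1,\dots,c_d\}$ of $d$ columns of $\mathsf{B}$, there is at least one row $r$ of $\mathsf{B}$ such that the entry of $\mathsf{B}$ in row $r$ and column $c_i$ equals $1$ for all $1\le i\le d$.
   Context: An $\mathsf{HHF}(N;k,(w_1,\dots,w_N))$ is an $N\times k$ array in which row $i$ contains at most $w_i$ distinct symbols. Given a set $S$ of columns and a partition of $S$ into $p$ classes (some possibly empty), a row $r$ separates it if any two columns in distinct classes have distinct entries in row $r$. A $\mathsf{DHHF}(N;k,(w_1,\dots,w_N),t,p)$ is an $\mathsf{HHF}(N;k,(w_1,\dots,w_N))$ in which every partition of every $t$-set of columns into $p$ classes is separated by some row. A cell of an array is a singleton if the symbol it contains occurs nowhere else in its row. The singleton array of an $n\times k$ array $\mathsf{A}$ is the $n\times k$ $0/1$ matrix whose $(r,c)$ entry is $1$ if cell $(r,c)$ of $\mathsf{A}$ is a singleton and $0$ otherwise. -}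

module Defs where

open import Data.Nat using (ℕ)
open import Data.Fin using (Fin)
open import Data.Product using (Σ; ∃; _×_)
open import Relation.Binary.PropositionalEquality using (_≡_; _≢_)
open import Function.Definitions using (Injective)
open import Data.Bool using (if_then_else_)
open import Relation.Nullary using (Dec; does; ¬?)
open import Relation.Nullary.Decidable using (_→-dec_)
open import Data.Fin.Properties using (all?) renaming (_≟_ to _F≟_)
open import Data.Nat.Properties renaming (_≟_ to _ℕ≟_) using ()

Array : ℕ → ℕ → Set
Array N k = Fin N → Fin k → ℕ

-- Row i uses at most w i distinct symbols: its entries factor through a set of size w i.
IsHHF : (N k : ℕ) → (w : Fin N → ℕ) → Array N k → Set
IsHHF N k w A = ∀ (i : Fin N) → Σ (Fin k → Fin (w i)) λ f →
  Σ (Fin (w i) → ℕ) λ g → ∀ (c : Fin k) → A i c ≡ g (f c)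

Separates : {N k t p : ℕ} → Array N k → Fin N → (Fin t → Fin k) → (Fin t → Fin p) → Set
Separates {t = t} A r col cls =
  ∀ (a b : Fin t) → cls a ≢ cls b → A r (col a) ≢ A r (col b)

-- DHHF(N; k, w, t, p): an HHF in which every partition of every t-set of columns
-- into p classes (some possibly empty) is separated by some row.
-- A t-set of columns is an injective map Fin t → Fin k.
IsDHHF : (N k : ℕ) → (w : Fin N → ℕ) → (t p : ℕ) → Array N k → Set
IsDHHF N k w t p A = IsHHF N k w A ×
  (∀ (col : Fin t → Fin k) → Injective _≡_ _≡_ col →
     ∀ (cls : Fin t → Fin p) → ∃ λ (r : Fin N) → Separates A r col cls)

IsSingleton : {N k : ℕ} → Array N k → Fin N → Fin k → Set
IsSingleton {k = k} A r c = ∀ (c' : Fin k) → c' ≢ c → A r c' ≢ A r c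

singleton? : {N k : ℕ} → (A : Array N k) → (r : Fin N) → (c : Fin k) → Dec (IsSingleton A r c)
singleton? A r c = all? λ c' → (¬? (c' F≟ c)) →-dec (¬? (A r c' ℕ≟ A r c))

singletonArray : {N k : ℕ} → Array N k → Fin N → Fin k → ℕ
singletonArray A r c = if does (singleton? A r c) then 1 else 0

-- Suppose no row has singletons in all the columns c₁ … c_d. Then every row r has a
-- column xᵣ ≠ c_{iᵣ} carrying the same symbol as c_{iᵣ}. Take n + d distinct columns
-- containing all xᵣ and all cᵢ, and split them into d + 1 ≤ p classes: class i + 1 is
-- {cᵢ} and class 0 holds the rest. Some row r separates this partition, yet xᵣ and c_{iᵣ}
-- lie in different classes and agree in row r.
module Submission where

open import Defs
open import Data.Bool using (if_then_else_)
open import Data.Nat using (ℕ; zero; suc; _+_; _≤_; _<_)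
open import Data.Nat.Properties using (<⇒≤; <⇒≱) renaming (_≟_ to _ℕ≟_)
open import Data.Fin using (Fin; zero; suc; _↑ˡ_; _↑ʳ_; inject≤)
open import Data.Fin.Properties using (any?; all?; ¬∀⟶∃¬; injective⇒≤; inject≤-injective)
  renaming (_≟_ to _F≟_)
open import Data.Vec.Functional using (Vector; []; _∷_; _++_)
open import Data.Vec.Functional.Properties using (lookup-++ˡ; lookup-++ʳ)
open import Data.Vec.Functional.Relation.Unary.Any using (Any; any)
open import Data.Product using (∃; _×_; _,_; proj₁; proj₂)
open import Function.Base using (_∘_)
open import Function.Definitions using (Injective)
open import Relation.Nullary using (¬_; Dec; yes; no; ¬?; does; contradiction)
open import Relation.Nullary.Decidable using (_→-dec_; decidable-stable)
open import Relation.Binary.PropositionalEquality using (_≡_; _≢_; refl; sym; trans; cong; module ≡-Reasoning)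
open ≡-Reasoning

private
  variable
    m k d : ℕ

_∈_ : {A : Set} → A → Vector A m → Set
y ∈ xs = Any (_≡ y) xs

_∉_ : {A : Set} → A → Vector A m → Set
y ∉ xs = ¬ (y ∈ xs)

_∈?_ : (y : Fin k) (xs : Vector (Fin k) m) → Dec (y ∈ xs)
y ∈? xs = any (_F≟ y) xs

∃∉ : m < k → (xs : Vector (Fin k) m) → ∃ λ y → y ∉ xs
∃∉ {m} {k} m<k xs with any? (λ y → ¬? (y ∈? xs))
... | yes fresh = fresh
... | no ¬fresh = contradiction (injective⇒≤ position-injective) (<⇒≱ m<k)
  where
  member : (y : Fin k) → y ∈ xs
  member y = decidable-stable (y ∈? xs) (λ y∉xs → ¬fresh (y , y∉xs))

  position : Fin k → Fin m
  position = proj₁ ∘ member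

  position-injective : Injective _≡_ _≡_ position
  position-injective {y} {y′} eq =
    trans (sym (proj₂ (member y))) (trans (cong xs eq) (proj₂ (member y′)))

fresh-∷-injective : {z : Fin k} {xs : Vector (Fin k) m} →
                    z ∉ xs → Injective _≡_ _≡_ xs → Injective _≡_ _≡_ (z ∷ xs)
fresh-∷-injective z∉xs xs-inj {zero}  {zero}  _  = refl
fresh-∷-injective z∉xs xs-inj {zero}  {suc j} eq = contradiction (j , sym eq) z∉xs
fresh-∷-injective z∉xs xs-inj {suc i} {zero}  eq = contradiction (i , eq) z∉xs
fresh-∷-injective z∉xs xs-inj {suc i} {suc j} eq = cong suc (xs-inj eq)

injective-cover : m ≤ k → (ys : Vector (Fin k) m) →
                  ∃ λ (xs : Vector (Fin k) m) → Injective _≡_ _≡_ xs × (∀ i → ys i ∈ xs)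
injective-cover {zero}  _   ys = [] , (λ {i} → λ {}) , λ ()
injective-cover {suc m} m<k ys
  with xs , xs-inj , covers ← injective-cover (<⇒≤ m<k) (ys ∘ suc)
  with ys zero ∈? xs
... | yes (j , xsj≡y) =
  let z , z∉xs = ∃∉ m<k xs in
  z ∷ xs , fresh-∷-injective z∉xs xs-inj ,
  λ { zero → suc j , xsj≡y ; (suc i) → let j′ , e = covers i in suc j′ , e }
... | no y∉xs =
  ys zero ∷ xs , fresh-∷-injective y∉xs xs-inj ,
  λ { zero → zero , refl ; (suc i) → let j′ , e = covers i in suc j′ , e }

classOf : Vector (Fin k) d → Fin k → Fin (suc d)
classOf cs y with y ∈? cs
... | yes (i , _) = suc i
... | no _        = zero

classOf-suc : (cs : Vector (Fin k) d) (y : Fin k) (j : Fin d) → classOf cs y ≡ suc j → cs j ≡ y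
classOf-suc cs y j eq with y ∈? cs
classOf-suc cs y j refl | yes (.j , csj≡y) = csj≡y

classOf-∈ : (cs : Vector (Fin k) d) {y : Fin k} → y ∈ cs → ∃ λ j → classOf cs y ≡ suc j
classOf-∈ cs {y} y∈cs with y ∈? cs
... | yes (j , _) = j , refl
... | no y∉cs     = contradiction y∈cs y∉cs

classOf-≡-∈⇒≡ : (cs : Vector (Fin k) d) {x y : Fin k} → x ∈ cs →
                classOf cs y ≡ classOf cs x → y ≡ x
classOf-≡-∈⇒≡ cs {x} {y} x∈cs same-class =
  let j , class-x = classOf-∈ cs x∈cs in
  trans (sym (classOf-suc cs y j (trans same-class class-x))) (classOf-suc cs x j class-x)

-- One chosen column xs r per row r and d further columns cs fit in an (n + d)-set of
-- columns, and the partition by classOf cs needs only d + 1 ≤ p classes.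
separating-row : ∀ {n k d p} (A : Array n k) → suc d ≤ p → n + d ≤ k →
                 (∀ (col : Fin (n + d) → Fin k) → Injective _≡_ _≡_ col →
                    ∀ (cls : Fin (n + d) → Fin p) → ∃ λ r → Separates A r col cls) →
                 (xs : Vector (Fin k) n) (cs : Vector (Fin k) d) →
                 ∃ λ r → ∀ i → xs r ≢ cs i → A r (xs r) ≢ A r (cs i)
separating-row {n} {d = d} A d<p n+d≤k separated xs cs
  with col , col-inj , covers ← injective-cover n+d≤k (xs ++ cs)
  with r , r-separates ← separated col col-inj (λ a → inject≤ (classOf cs (col a)) d<p)
  = r , distinct
  where
  distinct : ∀ i → xs r ≢ cs i → A r (xs r) ≢ A r (cs i)
  distinct i xr≢ci same-symbol
    with a , cola≡ ← covers (r ↑ˡ d) | b , colb≡ ← covers (n ↑ʳ i)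
    = r-separates a b different-classes
        (trans (cong (A r) col-a) (trans same-symbol (cong (A r) (sym col-b))))
    where
    col-a : col a ≡ xs r
    col-a = trans cola≡ (lookup-++ˡ xs cs r)

    col-b : col b ≡ cs i
    col-b = trans colb≡ (lookup-++ʳ xs cs i)

    different-classes : inject≤ (classOf cs (col a)) d<p ≢ inject≤ (classOf cs (col b)) d<p
    different-classes same-class = xr≢ci (classOf-≡-∈⇒≡ cs (i , refl) (begin
      classOf cs (xs r)   ≡⟨ cong (classOf cs) col-a ⟨
      classOf cs (col a)  ≡⟨ inject≤-injective d<p d<p _ _ same-class ⟩
      classOf cs (col b)  ≡⟨ cong (classOf cs) col-b ⟩
      classOf cs (cs i)   ∎))

if-does≡1 : {P : Set} (P? : Dec P) → P → (if does P? then 1 else 0) ≡ 1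
if-does≡1 (yes _) _ = refl
if-does≡1 (no ¬p) p = contradiction p ¬p

¬IsSingleton⇒collision : ∀ {n k} (A : Array n k) r x → ¬ IsSingleton A r x →
                         ∃ λ y → y ≢ x × A r y ≡ A r x
¬IsSingleton⇒collision {k = k} A r x ¬singleton
  with y , ¬collision-free ← ¬∀⟶∃¬ k _ (λ y → ¬? (y F≟ x) →-dec ¬? (A r y ℕ≟ A r x)) ¬singleton
  = y , (λ y≡x → ¬collision-free (λ y≢x → contradiction y≡x y≢x))
      , decidable-stable (A r y ℕ≟ A r x) (λ y≢x → ¬collision-free (λ _ → y≢x))

¬all-singleton⇒collision : ∀ {n k} (A : Array n k) r (cs : Vector (Fin k) d) →
                           ¬ (∀ i → IsSingleton A r (cs i)) →
                           ∃ λ i → ∃ λ y → y ≢ cs i × A r y ≡ A r (cs i)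
¬all-singleton⇒collision {d} A r cs ¬all-singleton
  with i , ¬singleton ← ¬∀⟶∃¬ d _ (λ i → singleton? A r (cs i)) ¬all-singleton
  = i , ¬IsSingleton⇒collision A r (cs i) ¬singleton

lemma6 : ∀ (n d p k : ℕ) (w : Fin n → ℕ) (A : Array n k) →
    suc d ≤ p → 2 ≤ suc d → n + d ≤ k →
    IsDHHF n k w (n + d) p A →
    ∀ (c : Fin d → Fin k) → Injective _≡_ _≡_ c →
    ∃ λ (r : Fin n) → ∀ (i : Fin d) → singletonArray A r (c i) ≡ 1
lemma6 n d p k w A d<p _ n+d≤k (_ , separated) c _
  with any? (λ r → all? (λ i → singleton? A r (c i)))
... | yes (r , singletons) = r , λ i → if-does≡1 (singleton? A r (c i)) (singletons i)
... | no ¬found =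
  let collision : ∀ r → ∃ λ i → ∃ λ y → y ≢ c i × A r y ≡ A r (c i)
      collision r = ¬all-singleton⇒collision A r c (λ all-singleton → ¬found (r , all-singleton))
      r , distinct = separating-row A d<p n+d≤k separated (proj₁ ∘ proj₂ ∘ collision) c
      i , _ , y≢ci , same-symbol = collision r
  in contradiction same-symbol (distinct i y≢ci)
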